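{- A semi-Heyting algebra satisfies all four identities (AT1), (AT2), (BT1), (BT2) if and only if it satisfies (BT1). Consequently $\mathbb{CSH}=\mathbb{BT}1$.
   Context: A semi-Heyting algebra is an algebra $\langle A;\wedge,\vee,\to,0,1\rangle$ such that $\langle A;\wedge,\vee,0,1\rangle$ is a bounded lattice and the identities $x\wedge(x\to y)\approx x\wedge y$, $x\wedge(y\to z)\approx x\wedge((x\wedge y)\to(x\wedge z))$, $x\to x\approx1$ hold. Write $x^*:=x\to0$. (AT1): $(x^*\to x)^*\approx1$; (AT2): $(x\to x^*)^*\approx1$; (BT1): $(x\to y)\to(x\to y^*)^*\approx1$; (BT2): $(x\to y^*)\to(x\to y)^*\approx1$. $\mathbb{CSH}$ (connexive semi-Heyting algebras) is the variety of semi-Heyting algebras satisfying all four identities, and $\mathbb{BT}1$ is the variety of semi-Heyting algebras satisfying (BT1). -}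

module Defs where

open import Level using (Level; _⊔_; suc)
open import Algebra.Core using (Op₂)
open import Algebra.Definitions using (Congruent₂)
open import Algebra.Lattice.Structures using (IsLattice)
open import Relation.Binary.Core using (Rel)

record IsSemiHeytingAlgebra {a ℓ} {A : Set a} (_≈_ : Rel A ℓ)
         (_∧_ _∨_ _⇒_ : Op₂ A) (0# 1# : A) : Set (a ⊔ ℓ) where
  field
    isLattice : IsLattice _≈_ _∨_ _∧_
    ⇒-cong    : Congruent₂ _≈_ _⇒_
    bottom    : ∀ x → (x ∧ 0#) ≈ 0#
    top       : ∀ x → (x ∨ 1#) ≈ 1#
    SH1       : ∀ x y → (x ∧ (x ⇒ y)) ≈ (x ∧ y)
    SH2       : ∀ x y z → (x ∧ (y ⇒ z)) ≈ (x ∧ ((x ∧ y) ⇒ (x ∧ z)))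
    SH3       : ∀ x → (x ⇒ x) ≈ 1#
  open IsLattice isLattice public

record SemiHeytingAlgebra (c ℓ : Level) : Set (suc (c ⊔ ℓ)) where
  infixr 5 _⇒_
  infixr 7 _∧_
  infixr 6 _∨_
  infix  4 _≈_
  field
    Carrier : Set c
    _≈_     : Rel Carrier ℓ
    _∧_     : Op₂ Carrier
    _∨_     : Op₂ Carrier
    _⇒_     : Op₂ Carrier
    0#      : Carrier
    1#      : Carrier
    isSemiHeytingAlgebra : IsSemiHeytingAlgebra _≈_ _∧_ _∨_ _⇒_ 0# 1#
  open IsSemiHeytingAlgebra isSemiHeytingAlgebra public

  _* : Carrier → Carrier
  x * = x ⇒ 0#

module _ {c ℓ} (S : SemiHeytingAlgebra c ℓ) where
  open SemiHeytingAlgebra S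

  AT1 : Set (c ⊔ ℓ)
  AT1 = ∀ x → ((x *) ⇒ x) * ≈ 1#

  AT2 : Set (c ⊔ ℓ)
  AT2 = ∀ x → (x ⇒ (x *)) * ≈ 1#

  BT1 : Set (c ⊔ ℓ)
  BT1 = ∀ x y → ((x ⇒ y) ⇒ ((x ⇒ (y *)) *)) ≈ 1#

  BT2 : Set (c ⊔ ℓ)
  BT2 = ∀ x y → ((x ⇒ (y *)) ⇒ ((x ⇒ y) *)) ≈ 1#

{-# OPTIONS --safe #-}
-- Instantiating (BT1) at (x, x) gives (AT2), and at (x*, x) gives (AT1) because
-- (x* → x*)* = 1* = 0. Instantiating it at (x, y*) gives (BT2) once we know
-- (x → y)* = (x → y**)*. For that, note that x* is the pseudocomplement of x, and
-- (AT2) at 0 forces 0 → 1 = 0, which yields x* ∧ (x → y) ≤ y*. Together with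
-- x ∧ (x → y) ≤ y this shows that (x → y)* depends only on y*, and y*** = y*.
module Submission where

open import Defs
open import Data.Product using (_×_; _,_)
open import Function.Bundles using (_⇔_; mk⇔)
open import Algebra.Lattice.Bundles using (Lattice)
import Algebra.Lattice.Properties.Lattice as LatticeProperties
open import Relation.Binary.Bundles using (Poset)
open import Relation.Binary.Lattice using (MeetSemilattice)
import Relation.Binary.Lattice.Properties.MeetSemilattice as MeetSemilatticeProperties
import Relation.Binary.Reasoning.PartialOrder as ≤-Reasoning

module SemiHeytingAlgebraProperties {c ℓ} (S : SemiHeytingAlgebra c ℓ) where
  open SemiHeytingAlgebra S

  lattice : Lattice c ℓ
  lattice = record { isLattice = isLattice }

  open LatticeProperties lattice using (poset; ∧-orderTheoreticMeetSemilattice)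
  open Poset poset using (_≤_)
    renaming (refl to ≤-refl; trans to ≤-trans; antisym to ≤-antisym)
  open MeetSemilattice ∧-orderTheoreticMeetSemilattice using (x∧y≤x; x∧y≤y; ∧-greatest)
  open MeetSemilatticeProperties ∧-orderTheoreticMeetSemilattice using (∧-monotonic)
  open ≤-Reasoning poset

  ∧-identityʳ : ∀ x → x ∧ 1# ≈ x
  ∧-identityʳ x = begin-equality
    x ∧ 1#        ≈⟨ ∧-congˡ (top x) ⟨
    x ∧ (x ∨ 1#)  ≈⟨ ∧-absorbs-∨ x 1# ⟩
    x             ∎

  ∧-identityˡ : ∀ x → 1# ∧ x ≈ x
  ∧-identityˡ x = trans (∧-comm 1# x) (∧-identityʳ x)

  ⇒-identityˡ : ∀ x → 1# ⇒ x ≈ x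
  ⇒-identityˡ x = begin-equality
    1# ⇒ x         ≈⟨ ∧-identityˡ (1# ⇒ x) ⟨
    1# ∧ (1# ⇒ x)  ≈⟨ SH1 1# x ⟩
    1# ∧ x         ≈⟨ ∧-identityˡ x ⟩
    x              ∎

  x∧x*≈0 : ∀ x → x ∧ x * ≈ 0#
  x∧x*≈0 x = trans (SH1 x 0#) (bottom x)

  x*≈1⇒x≈0 : ∀ {x} → x * ≈ 1# → x ≈ 0#
  x*≈1⇒x≈0 {x} x*≈1 = begin-equality
    x       ≈⟨ ∧-identityʳ x ⟨
    x ∧ 1#  ≈⟨ ∧-congˡ x*≈1 ⟨
    x ∧ x * ≈⟨ x∧x*≈0 x ⟩
    0#      ∎

  x≤0⇒x≈0 : ∀ {x} → x ≤ 0# → x ≈ 0#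
  x≤0⇒x≈0 {x} x≤0 = ≤-antisym x≤0 (begin
    0#      ≈⟨ bottom x ⟨
    x ∧ 0#  ≤⟨ x∧y≤x x 0# ⟩
    x       ∎)

  x≤y⇒x≤y*⇒x≈0 : ∀ {x y} → x ≤ y → x ≤ y * → x ≈ 0#
  x≤y⇒x≤y*⇒x≈0 {x} {y} x≤y x≤y* = x≤0⇒x≈0 (begin
    x        ≤⟨ ∧-greatest x≤y x≤y* ⟩
    y ∧ y *  ≈⟨ x∧x*≈0 y ⟩
    0#       ∎)

  x≤y*⇒x∧y≈0 : ∀ {x y} → x ≤ y * → x ∧ y ≈ 0#
  x≤y*⇒x∧y≈0 {x} {y} x≤y* = x≤y⇒x≤y*⇒x≈0 (x∧y≤y x y) (≤-trans (x∧y≤x x y) x≤y*)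

  x∧[x⇒y]≤y : ∀ x y → x ∧ (x ⇒ y) ≤ y
  x∧[x⇒y]≤y x y = begin
    x ∧ (x ⇒ y)  ≈⟨ SH1 x y ⟩
    x ∧ y        ≤⟨ x∧y≤y x y ⟩
    y            ∎

  x∧y≤[x⇒y] : ∀ x y → x ∧ y ≤ x ⇒ y
  x∧y≤[x⇒y] x y = begin
    x ∧ y        ≈⟨ SH1 x y ⟨
    x ∧ (x ⇒ y)  ≤⟨ x∧y≤y x (x ⇒ y) ⟩
    x ⇒ y        ∎

  x∧y≈0⇒x∧z≈0⇒x≤[y⇒z] : ∀ {x y z} → x ∧ y ≈ 0# → x ∧ z ≈ 0# → x ≤ y ⇒ z
  x∧y≈0⇒x∧z≈0⇒x≤[y⇒z] {x} {y} {z} x∧y≈0 x∧z≈0 = begin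
    x                        ≈⟨ ∧-identityʳ x ⟨
    x ∧ 1#                   ≈⟨ ∧-congˡ (SH3 0#) ⟨
    x ∧ (0# ⇒ 0#)            ≈⟨ ∧-congˡ (⇒-cong x∧y≈0 x∧z≈0) ⟨
    x ∧ ((x ∧ y) ⇒ (x ∧ z))  ≈⟨ SH2 x y z ⟨
    x ∧ (y ⇒ z)              ≤⟨ x∧y≤y x (y ⇒ z) ⟩
    y ⇒ z                    ∎

  x∧y≈0⇒x≤y* : ∀ {x y} → x ∧ y ≈ 0# → x ≤ y *
  x∧y≈0⇒x≤y* {x} x∧y≈0 = x∧y≈0⇒x∧z≈0⇒x≤[y⇒z] x∧y≈0 (bottom x)

  x*∧y*≤[x⇒y] : ∀ x y → x * ∧ y * ≤ x ⇒ y
  x*∧y*≤[x⇒y] x y = x∧y≈0⇒x∧z≈0⇒x≤[y⇒z]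
    (x≤y*⇒x∧y≈0 (x∧y≤x (x *) (y *)))
    (x≤y*⇒x∧y≈0 (x∧y≤y (x *) (y *)))

  *-antitone : ∀ {x y} → x ≤ y → y * ≤ x *
  *-antitone {x} {y} x≤y =
    x∧y≈0⇒x≤y* (x≤y⇒x≤y*⇒x≈0 (≤-trans (x∧y≤y (y *) x) x≤y) (x∧y≤x (y *) x))

  x≤x** : ∀ x → x ≤ x * *
  x≤x** x = x∧y≈0⇒x≤y* (x∧x*≈0 x)

  x***≈x* : ∀ x → x * * * ≈ x *
  x***≈x* x = ≤-antisym (*-antitone (x≤x** x)) (x≤x** (x *))

  module _ ([0⇒1]≈0 : 0# ⇒ 1# ≈ 0#) where

    x∧[0⇒x]≈0 : ∀ x → x ∧ (0# ⇒ x) ≈ 0#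
    x∧[0⇒x]≈0 x = begin-equality
      x ∧ (0# ⇒ x)               ≈⟨ ∧-congˡ (⇒-cong (bottom x) (∧-identityʳ x)) ⟨
      x ∧ ((x ∧ 0#) ⇒ (x ∧ 1#))  ≈⟨ SH2 x 0# 1# ⟨
      x ∧ (0# ⇒ 1#)              ≈⟨ ∧-congˡ [0⇒1]≈0 ⟩
      x ∧ 0#                     ≈⟨ bottom x ⟩
      0#                         ∎

    x*∧[x⇒y]≤y* : ∀ x y → x * ∧ (x ⇒ y) ≤ y *
    x*∧[x⇒y]≤y* x y = x∧y≈0⇒x≤y* (x≤0⇒x≈0 (begin
      u ∧ y                   ≤⟨ ∧-greatest ≤-refl (≤-trans (x∧y≤x u y) u≤[0⇒u∧y]) ⟩
      (u ∧ y) ∧ (0# ⇒ u ∧ y)  ≈⟨ x∧[0⇒x]≈0 (u ∧ y) ⟩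
      0#                      ∎))
      where
      u : Carrier
      u = x * ∧ (x ⇒ y)
      u≤[0⇒u∧y] : u ≤ 0# ⇒ u ∧ y
      u≤[0⇒u∧y] = begin
        u                        ≤⟨ ∧-greatest ≤-refl (x∧y≤y (x *) (x ⇒ y)) ⟩
        u ∧ (x ⇒ y)              ≈⟨ SH2 u x y ⟩
        u ∧ ((u ∧ x) ⇒ (u ∧ y))  ≈⟨ ∧-congˡ (⇒-cong (x≤y*⇒x∧y≈0 (x∧y≤x (x *) (x ⇒ y))) refl) ⟩
        u ∧ (0# ⇒ u ∧ y)         ≤⟨ x∧y≤y u (0# ⇒ u ∧ y) ⟩
        0# ⇒ u ∧ y               ∎

    -- (x ⇒ y)* ∧ (x ⇒ z) is 0 because it is disjoint from both x and x*.
    [x⇒y]*≤[x⇒z]* : ∀ x {y z} → y * ≈ z * → (x ⇒ y) * ≤ (x ⇒ z) *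
    [x⇒y]*≤[x⇒z]* x {y} {z} y*≈z* =
      x∧y≈0⇒x≤y* (x≤y⇒x≤y*⇒x≈0 (x∧y≈0⇒x≤y* v∧x≈0) (x∧y≈0⇒x≤y* v∧x*≈0))
      where
      v : Carrier
      v = (x ⇒ y) * ∧ (x ⇒ z)

      v≤[x⇒y]* : v ≤ (x ⇒ y) *
      v≤[x⇒y]* = x∧y≤x ((x ⇒ y) *) (x ⇒ z)

      v≤[x⇒z] : v ≤ x ⇒ z
      v≤[x⇒z] = x∧y≤y ((x ⇒ y) *) (x ⇒ z)

      v∧x≈0 : v ∧ x ≈ 0#
      v∧x≈0 = x≤y⇒x≤y*⇒x≈0 v∧x≤z v∧x≤z*
        where
        v∧x≤z : v ∧ x ≤ z
        v∧x≤z = begin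
          v ∧ x        ≤⟨ ∧-greatest (x∧y≤y v x) (≤-trans (x∧y≤x v x) v≤[x⇒z]) ⟩
          x ∧ (x ⇒ z)  ≤⟨ x∧[x⇒y]≤y x z ⟩
          z            ∎
        v∧x∧y≤[x⇒y] : (v ∧ x) ∧ y ≤ x ⇒ y
        v∧x∧y≤[x⇒y] = begin
          (v ∧ x) ∧ y  ≤⟨ ∧-monotonic (x∧y≤y v x) ≤-refl ⟩
          x ∧ y        ≤⟨ x∧y≤[x⇒y] x y ⟩
          x ⇒ y        ∎
        v∧x∧y≤[x⇒y]* : (v ∧ x) ∧ y ≤ (x ⇒ y) *
        v∧x∧y≤[x⇒y]* = ≤-trans (≤-trans (x∧y≤x (v ∧ x) y) (x∧y≤x v x)) v≤[x⇒y]*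
        v∧x≤z* : v ∧ x ≤ z *
        v∧x≤z* = begin
          v ∧ x  ≤⟨ x∧y≈0⇒x≤y* (x≤y⇒x≤y*⇒x≈0 v∧x∧y≤[x⇒y] v∧x∧y≤[x⇒y]*) ⟩
          y *    ≈⟨ y*≈z* ⟩
          z *    ∎

      v∧x*≈0 : v ∧ x * ≈ 0#
      v∧x*≈0 = x≤y⇒x≤y*⇒x≈0 v∧x*≤[x⇒y] (≤-trans (x∧y≤x v (x *)) v≤[x⇒y]*)
        where
        v∧x*≤y* : v ∧ x * ≤ y *
        v∧x*≤y* = begin
          v ∧ x *          ≤⟨ ∧-greatest (x∧y≤y v (x *)) (≤-trans (x∧y≤x v (x *)) v≤[x⇒z]) ⟩
          x * ∧ (x ⇒ z)    ≤⟨ x*∧[x⇒y]≤y* x z ⟩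
          z *              ≈⟨ y*≈z* ⟨
          y *              ∎
        v∧x*≤[x⇒y] : v ∧ x * ≤ x ⇒ y
        v∧x*≤[x⇒y] = begin
          v ∧ x *  ≤⟨ ∧-greatest (x∧y≤y v (x *)) v∧x*≤y* ⟩
          x * ∧ y *  ≤⟨ x*∧y*≤[x⇒y] x y ⟩
          x ⇒ y      ∎

    y*≈z*⇒[x⇒y]*≈[x⇒z]* : ∀ x {y z} → y * ≈ z * → (x ⇒ y) * ≈ (x ⇒ z) *
    y*≈z*⇒[x⇒y]*≈[x⇒z]* x y*≈z* = ≤-antisym ([x⇒y]*≤[x⇒z]* x y*≈z*) ([x⇒y]*≤[x⇒z]* x (sym y*≈z*))

  AT2⇒[0⇒1]≈0 : AT2 S → 0# ⇒ 1# ≈ 0#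
  AT2⇒[0⇒1]≈0 at2 = x*≈1⇒x≈0 (begin-equality
    (0# ⇒ 1#) *    ≈⟨ ⇒-cong (⇒-cong refl (SH3 0#)) refl ⟨
    (0# ⇒ 0# *) *  ≈⟨ at2 0# ⟩
    1#             ∎)

  BT1⇒AT2 : BT1 S → AT2 S
  BT1⇒AT2 bt1 x = begin-equality
    (x ⇒ x *) *              ≈⟨ ⇒-identityˡ _ ⟨
    1# ⇒ (x ⇒ x *) *         ≈⟨ ⇒-cong (SH3 x) refl ⟨
    (x ⇒ x) ⇒ (x ⇒ x *) *    ≈⟨ bt1 x x ⟩
    1#                       ∎

  BT1⇒AT1 : BT1 S → AT1 S
  BT1⇒AT1 bt1 x = begin-equality
    (x * ⇒ x) ⇒ 0#              ≈⟨ ⇒-cong refl (⇒-identityˡ 0#) ⟨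
    (x * ⇒ x) ⇒ 1# *            ≈⟨ ⇒-cong refl (⇒-cong (SH3 (x *)) refl) ⟨
    (x * ⇒ x) ⇒ (x * ⇒ x *) *   ≈⟨ bt1 (x *) x ⟩
    1#                          ∎

  BT1⇒BT2 : BT1 S → BT2 S
  BT1⇒BT2 bt1 x y = begin-equality
    (x ⇒ y *) ⇒ (x ⇒ y) *       ≈⟨ ⇒-cong refl [x⇒y]*≈[x⇒y**]* ⟩
    (x ⇒ y *) ⇒ (x ⇒ y * *) *   ≈⟨ bt1 x (y *) ⟩
    1#                          ∎
    where
    [x⇒y]*≈[x⇒y**]* : (x ⇒ y) * ≈ (x ⇒ y * *) *
    [x⇒y]*≈[x⇒y**]* =
      y*≈z*⇒[x⇒y]*≈[x⇒z]* (AT2⇒[0⇒1]≈0 (BT1⇒AT2 bt1)) x (sym (x***≈x* y))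

corollary5p12 : ∀ {c ℓ} (S : SemiHeytingAlgebra c ℓ) → (AT1 S × AT2 S × BT1 S × BT2 S) ⇔ BT1 S
corollary5p12 S = mk⇔
  (λ (_ , _ , bt1 , _) → bt1)
  (λ bt1 → BT1⇒AT1 bt1 , BT1⇒AT2 bt1 , bt1 , BT1⇒BT2 bt1)
  where open SemiHeytingAlgebraProperties S
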